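{- Let $n\ge 3$ and let $A=(a_{pq})$ be an $n\times n$ matrix. Then $$\mathrm{Cycl}(A)=\sum_{j=2}^{n} a_{1j}\,\mathrm{Cycl}(\overline{A}_{1j}).$$
   Context: $\mathcal{S}^{(N)}$ is the symmetric group on $\{1,\dots,N\}$; a full cycle is a permutation in $\mathcal{S}^{(N)}$ consisting of a single cycle of length $N$. For a square matrix $B=(b_{pq})$ of order $N$, its cyclic permanent is $\mathrm{Cycl}(B)=\sum_{s}\prod_{p=1}^{N} b_{p,s(p)}$, the sum being over all full cycles $s\in\mathcal{S}^{(N)}$. For an $n\times n$ matrix $A$ with columns $c_1,\dots,c_n$ and $2\le j\le n$, $\overline{A}_{1j}$ is the $(n-1)\times(n-1)$ matrix obtained by deleting row $1$ and column $j$ and arranging the remaining columns in the order $c_2,c_3,\dots,c_{j-1},c_1,c_{j+1},\dots,c_n$; explicitly its $(p,q)$ entry is $a_{p+1,\psi(q)}$ with $\psi(q)=q+1$ for $q\ne j-1$ and $\psi(j-1)=1$. -}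

module Defs where

open import Level using (Level)
open import Data.Nat using (ℕ; zero; suc)
open import Data.Fin using (Fin; zero; suc; toℕ; _≟_)
open import Data.Fin.Properties using (all?)
open import Data.Product using (_×_)
open import Data.Bool using (if_then_else_)
open import Relation.Nullary using (Dec; ¬_; does)
open import Relation.Nullary.Decidable using (_×-dec_; _→-dec_)
open import Relation.Binary.PropositionalEquality using (_≡_)
open import Algebra.Bundles using (CommutativeRing)
open import Function using (_∘_)

iter : ∀ {N} → (Fin N → Fin N) → ℕ → Fin N → Fin N
iter s zero    x = x
iter s (suc k) x = s (iter s k x)

-- s : Fin N → Fin N is a full cycle (a permutation consisting of a single
-- cycle of length N): for every point x, the iterates s^k(x), k < N, are
-- pairwise distinct (so they exhaust Fin N) and s^N(x) = x.
IsFullCycle : ∀ {N} → (Fin N → Fin N) → Set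
IsFullCycle {N} s =
  ∀ (x : Fin N) →
    (∀ (k l : Fin N) → iter s (toℕ k) x ≡ iter s (toℕ l) x → k ≡ l)
    × iter s N x ≡ x

isFullCycle? : ∀ {N} (s : Fin N → Fin N) → Dec (IsFullCycle s)
isFullCycle? {N} s = all? λ x →
  (all? λ k → all? λ l → (iter s (toℕ k) x ≟ iter s (toℕ l) x) →-dec (k ≟ l))
  ×-dec (iter s N x ≟ x)

cons : ∀ {n m} → Fin m → (Fin n → Fin m) → Fin (suc n) → Fin m
cons v g zero    = v
cons v g (suc i) = g i

module _ {c ℓ : Level} (R : CommutativeRing c ℓ) where
  open CommutativeRing R using (Carrier; _+_; _*_; 0#; 1#)

  Matrix : ℕ → Set c
  Matrix N = Fin N → Fin N → Carrier

  ∑ : ∀ {n} → (Fin n → Carrier) → Carrier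
  ∑ {zero}  f = 0#
  ∑ {suc n} f = f zero + ∑ (f ∘ suc)

  ∏ : ∀ {n} → (Fin n → Carrier) → Carrier
  ∏ {zero}  f = 1#
  ∏ {suc n} f = f zero * ∏ (f ∘ suc)

  ∑Fun : ∀ {n m} → ((Fin n → Fin m) → Carrier) → Carrier
  ∑Fun {zero}  F = F (λ ())
  ∑Fun {suc n} F = ∑ λ v → ∑Fun (λ g → F (cons v g))

  Cycl : ∀ {N} → Matrix N → Carrier
  Cycl {N} B = ∑Fun {N} {N} λ s →
    if does (isFullCycle? s) then ∏ (λ p → B p (s p)) else 0#

  -- ψ for column j = j'+2 (1-indexed); 0-indexed: ψ q = 0 if q = j', else q+1
  ψ : ∀ {k} → Fin k → Fin k → Fin (suc k)
  ψ j' q = if does (q ≟ j') then zero else suc q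

  -- Ā_{1j} for A of order k+1 and j = j'+2 (1-indexed), j' : Fin k
  Abar : ∀ {k} → Matrix (suc k) → Fin k → Matrix k
  Abar A j' p q = A (suc p) (ψ j' q)

-- Sort the full cycles s of {1,…,n} by the value s(1). For n ≥ 2 no full cycle fixes 1,
-- and a full cycle with s(1) = j never sends another point to j. Deleting 1 from such a
-- cycle, i.e. letting s⁻¹(1) jump straight to j, is a bijection onto the full cycles of
-- the remaining n − 1 points; in the labelling of Ā₁ⱼ, whose column order puts column 1
-- at position j, it leaves every other factor a_{p,s(p)} unchanged and removes a_{1j}.
module Submission where

open import Level using (Level)
open import Data.Bool using (Bool; true; false; if_then_else_)
open import Data.Empty using (⊥-elim)
open import Data.Fin using (Fin; zero; suc; toℕ; fromℕ; fromℕ<; inject₁; punchOut; _≟_)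
open import Data.Fin.Properties
  using (any?; pigeonhole; injective⇒≤; punchOut-injective; toℕ<n; toℕ-fromℕ<;
         toℕ-fromℕ; toℕ-inject₁; fromℕ≢inject₁; suc-injective)
open import Data.Nat using (ℕ; zero; suc; _≤_; _<_; _<?_; s≤s⁻¹; z≤n; s≤s)
import Data.Nat.Properties as ℕ
open import Data.Product using (∃; _,_; proj₁; proj₂)
open import Data.Sum using (_⊎_; inj₁; inj₂)
open import Function using (_∘_; _⇔_; mk⇔; Injective; StrictlySurjective)
open import Relation.Binary.Core using (_Preserves_⟶_)
open import Relation.Binary.Definitions using (_Respects_)
open import Relation.Binary.PropositionalEquality
  using (_≡_; _≢_; _≗_; refl; sym; trans; cong; subst; module ≡-Reasoning)
open import Relation.Nullary using (yes; no; ¬_; does; contradiction)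
open import Relation.Nullary.Decidable using (dec-false; does-⇔)
open import Algebra.Bundles using (CommutativeRing)
open import Defs

module FullCycles where

  open import Data.Nat using (_+_; _∸_)

  injective⇒surjective : ∀ {N} {f : Fin N → Fin N} → Injective _≡_ _≡_ f → StrictlySurjective _≡_ f
  injective⇒surjective {suc n} {f} f-inj y with any? (λ x → f x ≟ y)
  ... | yes hit = hit
  ... | no miss = contradiction (injective⇒≤ avoid-injective) ℕ.1+n≰n
    where
    avoid : Fin (suc n) → Fin n
    avoid x = punchOut {i = y} {j = f x} (miss ∘ (x ,_) ∘ sym)

    avoid-injective : Injective _≡_ _≡_ avoid
    avoid-injective eq = f-inj (punchOut-injective {i = y} _ _ eq)

  surjective⇒injective : ∀ {N} {f : Fin N → Fin N} → StrictlySurjective _≡_ f → Injective _≡_ _≡_ f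
  surjective⇒injective {N} {f} f-surj {x} {x′} fx≡fx′ =
    trans (sym (g∘f x)) (trans (cong g fx≡fx′) (g∘f x′))
    where
    g : Fin N → Fin N
    g = proj₁ ∘ f-surj

    f∘g : ∀ y → f (g y) ≡ y
    f∘g = proj₂ ∘ f-surj

    g-surj : StrictlySurjective _≡_ g
    g-surj = injective⇒surjective λ {y} {y′} gy≡gy′ →
      trans (sym (f∘g y)) (trans (cong f gy≡gy′) (f∘g y′))

    g∘f : ∀ x → g (f x) ≡ x
    g∘f x with y , gy≡x ← g-surj x = trans (cong (g ∘ f) (sym gy≡x)) (trans (cong g (f∘g y)) gy≡x)

  private variable
    N : ℕ

  iter-+ : (s : Fin N → Fin N) → ∀ m n x → iter s (m + n) x ≡ iter s m (iter s n x)
  iter-+ s zero    n x = refl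
  iter-+ s (suc m) n x = cong s (iter-+ s m n x)

  iter-suc : (s : Fin N → Fin N) → ∀ m x → iter s (suc m) x ≡ iter s m (s x)
  iter-suc s zero    x = refl
  iter-suc s (suc m) x = cong s (iter-suc s m x)

  orbit : (Fin N → Fin N) → Fin N → Fin N → Fin N
  orbit s x i = iter s (toℕ i) x

  Reachable : (Fin N → Fin N) → Fin N → Fin N → Set
  Reachable s x y = ∃ λ m → iter s m x ≡ y

  StronglyConnected : (Fin N → Fin N) → Set
  StronglyConnected s = ∀ x y → Reachable s x y

  reachable-trans : (s : Fin N → Fin N) → ∀ {x y z} → Reachable s x y → Reachable s y z → Reachable s x z
  reachable-trans s (m , refl) (n , refl) = n + m , iter-+ s n m _

  stronglyConnected⇒surjective : (s : Fin N → Fin N) → StronglyConnected s → StrictlySurjective _≡_ s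
  stronglyConnected⇒surjective s conn y with m , eq ← conn (s y) y =
    iter s m y , trans (iter-suc s m y) eq

  isFullCycle⇒injective : (s : Fin N → Fin N) → IsFullCycle s → Injective _≡_ _≡_ s
  isFullCycle⇒injective {suc n} s fc {x} {y} sx≡sy = begin
    x                  ≡⟨ sym (proj₂ (fc x)) ⟩
    iter s (suc n) x   ≡⟨ iter-suc s n x ⟩
    iter s n (s x)     ≡⟨ cong (iter s n) sx≡sy ⟩
    iter s n (s y)     ≡⟨ sym (iter-suc s n y) ⟩
    iter s (suc n) y   ≡⟨ proj₂ (fc y) ⟩
    y                  ∎
    where open ≡-Reasoning

  isFullCycle⇒stronglyConnected : (s : Fin N → Fin N) → IsFullCycle s → StronglyConnected s
  isFullCycle⇒stronglyConnected s fc x y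
    with i , eq ← injective⇒surjective (λ {k} {l} → proj₁ (fc x) k l) y = toℕ i , eq

  -- Pigeonhole on the N + 1 points s⁰x, …, sᴺx gives sᵃx = sᵇx with a < b ≤ N,
  -- so sᴺx = s^(N − b + a) x with N − b + a < N.
  iterN∈orbit : (s : Fin N → Fin N) → ∀ x → ∃ λ i → orbit s x i ≡ iter s N x
  iterN∈orbit {N} s x
    with a , b , a<b , sᵃx≡sᵇx ← pigeonhole (ℕ.n<1+n N) (λ (i : Fin (suc N)) → iter s (toℕ i) x) =
    fromℕ< r<N , trans (cong (λ m → iter s m x) (toℕ-fromℕ< r<N)) sʳx≡sᴺx
    where
    open ≡-Reasoning
    b≤N : toℕ b ≤ N
    b≤N = s≤s⁻¹ (toℕ<n b)

    r = N ∸ toℕ b + toℕ a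

    r<N : r < N
    r<N = subst (r <_) (ℕ.m∸n+n≡m b≤N) (ℕ.+-monoʳ-< (N ∸ toℕ b) a<b)

    sʳx≡sᴺx : iter s r x ≡ iter s N x
    sʳx≡sᴺx = begin
      iter s r x                              ≡⟨ iter-+ s (N ∸ toℕ b) (toℕ a) x ⟩
      iter s (N ∸ toℕ b) (iter s (toℕ a) x)   ≡⟨ cong (iter s (N ∸ toℕ b)) sᵃx≡sᵇx ⟩
      iter s (N ∸ toℕ b) (iter s (toℕ b) x)   ≡⟨ sym (iter-+ s (N ∸ toℕ b) (toℕ b) x) ⟩
      iter s (N ∸ toℕ b + toℕ b) x            ≡⟨ cong (λ m → iter s m x) (ℕ.m∸n+n≡m b≤N) ⟩
      iter s N x                              ∎

  orbit-closed : (s : Fin N → Fin N) → ∀ x i → ∃ λ j → orbit s x j ≡ s (orbit s x i)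
  orbit-closed {N} s x i with suc (toℕ i) <? N
  ... | yes i+1<N = fromℕ< i+1<N , cong (λ m → iter s m x) (toℕ-fromℕ< i+1<N)
  ... | no  i+1≮N = subst (λ m → ∃ λ j → orbit s x j ≡ iter s m x)
                          (ℕ.≤-antisym (ℕ.≮⇒≥ i+1≮N) (toℕ<n i))
                          (iterN∈orbit s x)

  iter∈orbit : (s : Fin N → Fin N) → ∀ m x → ∃ λ i → orbit s x i ≡ iter s m x
  iter∈orbit {suc n} s zero x = zero , refl
  iter∈orbit s (suc m) x with i , eq ← iter∈orbit s m x with j , eq′ ← orbit-closed s x i =
    j , trans eq′ (cong s eq)

  stronglyConnected⇒orbit-surjective : (s : Fin N → Fin N) → StronglyConnected s →
                                       ∀ x → StrictlySurjective _≡_ (orbit s x)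
  stronglyConnected⇒orbit-surjective s conn x y with m , refl ← conn x y = iter∈orbit s m x

  -- If sᴺx = sⁱ⁺¹x with i + 1 < N then the orbit of s x repeats before step N.
  stronglyConnected⇒iterN≡id : (s : Fin N → Fin N) → StronglyConnected s → ∀ x → iter s N x ≡ x
  stronglyConnected⇒iterN≡id {suc n} s conn x
    with stronglyConnected⇒orbit-surjective s conn x (iter s (suc n) x)
  ... | zero  , x≡sᴺx = sym x≡sᴺx
  ... | suc i , eq    = ⊥-elim (fromℕ≢inject₁ {i = i} (sym
    (surjective⇒injective (stronglyConnected⇒orbit-surjective s conn (s x)) (begin
      iter s (toℕ (inject₁ i)) (s x)   ≡⟨ cong (λ m → iter s m (s x)) (toℕ-inject₁ i) ⟩
      iter s (toℕ i) (s x)             ≡⟨ sym (iter-suc s (toℕ i) x) ⟩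
      iter s (suc (toℕ i)) x           ≡⟨ eq ⟩
      iter s (suc n) x                 ≡⟨ iter-suc s n x ⟩
      iter s n (s x)                   ≡⟨ cong (λ m → iter s m (s x)) (sym (toℕ-fromℕ n)) ⟩
      iter s (toℕ (fromℕ n)) (s x)     ∎))))
    where open ≡-Reasoning

  stronglyConnected⇒isFullCycle : (s : Fin N → Fin N) → StronglyConnected s → IsFullCycle s
  stronglyConnected⇒isFullCycle s conn x =
    (λ k l → surjective⇒injective (stronglyConnected⇒orbit-surjective s conn x)) ,
    stronglyConnected⇒iterN≡id s conn x

  isFullCycle-resp-≗ : IsFullCycle {N} Respects _≗_
  isFullCycle-resp-≗ {N} {s} {s′} s≗s′ fc x =
    (λ k l eq → proj₁ (fc x) k l (trans (iter-≗ (toℕ k)) (trans eq (sym (iter-≗ (toℕ l)))))) ,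
    trans (sym (iter-≗ N)) (proj₂ (fc x))
    where
    iter-≗ : ∀ m → iter s m x ≡ iter s′ m x
    iter-≗ zero    = refl
    iter-≗ (suc m) = trans (s≗s′ _) (cong s′ (iter-≗ m))

  ¬isFullCycle-cons-repeat : ∀ {n} {v : Fin (suc n)} {g : Fin n → Fin (suc n)} p →
                             g p ≡ v → ¬ IsFullCycle (cons v g)
  ¬isFullCycle-cons-repeat {v = v} {g} p gp≡v fc
    with isFullCycle⇒injective (cons v g) fc {zero} {suc p} (sym gp≡v)
  ... | ()

  ¬isFullCycle-fixedPoint : ∀ {N} {s : Fin (suc (suc N)) → Fin (suc (suc N))} {x} →
                            s x ≡ x → ¬ IsFullCycle s
  ¬isFullCycle-fixedPoint {x = x} sx≡x fc with proj₁ (fc x) zero (suc zero) (sym sx≡x)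
  ... | ()

  -- Defs.ψ without its unused ring parameter, so that Abar R A j p q = A (suc p) (ψ′ j q)
  -- holds by definition.
  ψ′ : ∀ {k} → Fin k → Fin k → Fin (suc k)
  ψ′ j q = if does (q ≟ j) then zero else suc q

  ψ′-self : ∀ {k} (j : Fin k) → ψ′ j j ≡ zero
  ψ′-self j with j ≟ j
  ... | yes _   = refl
  ... | no  j≢j = contradiction refl j≢j

  ψ′-other : ∀ {k} {j q : Fin k} → q ≢ j → ψ′ j q ≡ suc q
  ψ′-other {j = j} {q} q≢j with q ≟ j
  ... | yes q≡j = contradiction q≡j q≢j
  ... | no  _   = refl

  contract : ∀ {k} → Fin k → Fin (suc k) → Fin k
  contract j zero    = j
  contract j (suc y) = y

  contract-ψ′ : ∀ {k} (j q : Fin k) → contract j (ψ′ j q) ≡ q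
  contract-ψ′ j q with q ≟ j
  ... | yes q≡j = sym q≡j
  ... | no  _   = refl

  cons-cong : ∀ {n m} (v : Fin m) {g g′ : Fin n → Fin m} → g ≗ g′ → cons v g ≗ cons v g′
  cons-cong v g≗g′ zero    = refl
  cons-cong v g≗g′ (suc p) = g≗g′ p

  cons-∘ : ∀ {n m m′} (f : Fin m → Fin m′) v (t : Fin n → Fin m) → cons (f v) (f ∘ t) ≗ f ∘ cons v t
  cons-∘ f v t zero    = refl
  cons-∘ f v t (suc p) = refl

  -- The point zero is inserted on the edge of t leading into j.
  splice : ∀ {k} → Fin k → (Fin k → Fin k) → Fin (suc k) → Fin (suc k)
  splice j t = cons (suc j) (ψ′ j ∘ t)

  module _ {k} (j : Fin k) (t : Fin k → Fin k) where

    private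
      s : Fin (suc k) → Fin (suc k)
      s = splice j t

    contract-step : ∀ z → contract j (s z) ≡ contract j z ⊎ contract j (s z) ≡ t (contract j z)
    contract-step zero    = inj₁ refl
    contract-step (suc p) = inj₂ (contract-ψ′ j (t p))

    contract-iter : ∀ m z → Reachable t (contract j z) (contract j (iter s m z))
    contract-iter zero    z = 0 , refl
    contract-iter (suc m) z with m′ , eq ← contract-iter m z | contract-step (iter s m z)
    ... | inj₁ stay = m′ , trans eq (sym stay)
    ... | inj₂ move = suc m′ , trans (cong t eq) (sym move)

    suc-step : ∀ p → Reachable s (suc p) (suc (t p))
    suc-step p with t p ≟ j
    ... | yes tp≡j = 2 , trans (cong s (trans (cong (ψ′ j) tp≡j) (ψ′-self j))) (cong suc (sym tp≡j))
    ... | no  tp≢j = 1 , ψ′-other tp≢j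

    suc-reachable : ∀ {x y} → Reachable t x y → Reachable s (suc x) (suc y)
    suc-reachable {x} (m , refl) = lift m
      where
      lift : ∀ m → Reachable s (suc x) (suc (iter t m x))
      lift zero    = 0 , refl
      lift (suc m) = reachable-trans s (lift m) (suc-step (iter t m x))

    reachable-from-suc : StronglyConnected t → ∀ x y → Reachable s (suc x) y
    reachable-from-suc conn x (suc y) = suc-reachable (conn x y)
    reachable-from-suc conn x zero with p , tp≡j ← stronglyConnected⇒surjective t conn j =
      reachable-trans s (suc-reachable (conn x p)) (1 , trans (cong (ψ′ j) tp≡j) (ψ′-self j))

    splice-stronglyConnected : StronglyConnected t → StronglyConnected s
    splice-stronglyConnected conn zero    y = reachable-trans s (1 , refl) (reachable-from-suc conn j y)
    splice-stronglyConnected conn (suc x) y = reachable-from-suc conn x y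

    contract-stronglyConnected : StronglyConnected s → StronglyConnected t
    contract-stronglyConnected conn x y with m , eq ← conn (suc x) (suc y) =
      subst (Reachable t x) (cong (contract j) eq) (contract-iter m (suc x))

    isFullCycle-splice : IsFullCycle s ⇔ IsFullCycle t
    isFullCycle-splice = mk⇔
      (stronglyConnected⇒isFullCycle t ∘ contract-stronglyConnected ∘ isFullCycle⇒stronglyConnected s)
      (stronglyConnected⇒isFullCycle s ∘ splice-stronglyConnected ∘ isFullCycle⇒stronglyConnected t)

open FullCycles

module _ {c ℓ : Level} (R : CommutativeRing c ℓ) where

  open CommutativeRing R
    using (Carrier; _≈_; _+_; _*_; 0#; setoid; reflexive; +-cong; +-congˡ; +-congʳ; *-cong;
           +-assoc; +-comm; +-identityˡ; +-identityʳ; zeroʳ; distribˡ; +-commutativeSemigroup)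
    renaming (refl to ≈-refl; sym to ≈-sym; trans to ≈-trans)
  open import Relation.Binary.Reasoning.Setoid setoid
  open import Algebra.Properties.CommutativeSemigroup +-commutativeSemigroup using (xy∙z≈zy∙x)

  ∑-cong : ∀ {n} {f g : Fin n → Carrier} → (∀ i → f i ≈ g i) → ∑ R f ≈ ∑ R g
  ∑-cong {zero}  f≈g = ≈-refl
  ∑-cong {suc n} f≈g = +-cong (f≈g zero) (∑-cong (f≈g ∘ suc))

  ∏-cong : ∀ {n} {f g : Fin n → Carrier} → (∀ i → f i ≈ g i) → ∏ R f ≈ ∏ R g
  ∏-cong {zero}  f≈g = ≈-refl
  ∏-cong {suc n} f≈g = *-cong (f≈g zero) (∏-cong (f≈g ∘ suc))

  ∑-zero : ∀ {n} {f : Fin n → Carrier} → (∀ i → f i ≈ 0#) → ∑ R f ≈ 0#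
  ∑-zero {zero}  f≈0 = ≈-refl
  ∑-zero {suc n} f≈0 = ≈-trans (+-cong (f≈0 zero) (∑-zero (f≈0 ∘ suc))) (+-identityˡ 0#)

  *-distribˡ-∑ : ∀ {n} a (f : Fin n → Carrier) → a * ∑ R f ≈ ∑ R (λ i → a * f i)
  *-distribˡ-∑ {zero}  a f = zeroʳ a
  *-distribˡ-∑ {suc n} a f = ≈-trans (distribˡ a _ _) (+-congˡ (*-distribˡ-∑ a (f ∘ suc)))

  ∑-agreeExcept : ∀ {n} (j : Fin n) (f g : Fin n → Carrier) → (∀ i → i ≢ j → f i ≈ g i) →
                  ∑ R f + g j ≈ ∑ R g + f j
  ∑-agreeExcept zero f g f≈g = ≈-trans (xy∙z≈zy∙x _ _ _)
    (+-congʳ (+-congˡ (∑-cong λ i → f≈g (suc i) λ ())))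
  ∑-agreeExcept (suc j) f g f≈g = begin
    (f zero + ∑ R (f ∘ suc)) + g (suc j)   ≈⟨ +-assoc _ _ _ ⟩
    f zero + (∑ R (f ∘ suc) + g (suc j))   ≈⟨ +-cong (f≈g zero λ ()) (∑-agreeExcept j (f ∘ suc) (g ∘ suc)
                                                λ i i≢j → f≈g (suc i) (i≢j ∘ suc-injective)) ⟩
    g zero + (∑ R (g ∘ suc) + f (suc j))   ≈⟨ +-assoc _ _ _ ⟨
    (g zero + ∑ R (g ∘ suc)) + f (suc j)   ∎

  ∑-ψ′ : ∀ {k} (j : Fin k) (f : Fin (suc k) → Carrier) → ∑ R f ≈ ∑ R (f ∘ ψ′ j) + f (suc j)
  ∑-ψ′ j f = begin
    f zero + ∑ R (f ∘ suc)         ≈⟨ +-comm _ _ ⟩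
    ∑ R (f ∘ suc) + f zero         ≡⟨ cong (λ z → ∑ R (f ∘ suc) + f z) (ψ′-self j) ⟨
    ∑ R (f ∘ suc) + f (ψ′ j j)     ≈⟨ ∑-agreeExcept j (f ∘ suc) (f ∘ ψ′ j)
                                        (λ q q≢j → reflexive (cong f (sym (ψ′-other q≢j)))) ⟩
    ∑ R (f ∘ ψ′ j) + f (suc j)     ∎

  ∑Fun-cong : ∀ {n m} {F G : (Fin n → Fin m) → Carrier} → (∀ g → F g ≈ G g) → ∑Fun R F ≈ ∑Fun R G
  ∑Fun-cong {zero}  F≈G = F≈G _
  ∑Fun-cong {suc n} F≈G = ∑-cong λ v → ∑Fun-cong {n} λ g → F≈G (cons v g)

  ∑Fun-zero : ∀ {n m} {F : (Fin n → Fin m) → Carrier} → (∀ g → F g ≈ 0#) → ∑Fun R F ≈ 0#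
  ∑Fun-zero {zero}  F≈0 = F≈0 _
  ∑Fun-zero {suc n} F≈0 = ∑-zero λ v → ∑Fun-zero {n} λ g → F≈0 (cons v g)

  *-distribˡ-∑Fun : ∀ {n m} a (F : (Fin n → Fin m) → Carrier) → a * ∑Fun R F ≈ ∑Fun R (λ g → a * F g)
  *-distribˡ-∑Fun {zero}  a F = ≈-refl
  *-distribˡ-∑Fun {suc n} a F = ≈-trans (*-distribˡ-∑ a (λ v → ∑Fun R (F ∘ cons v)))
                                         (∑-cong λ v → *-distribˡ-∑Fun {n} a (F ∘ cons v))

  -- Functions avoiding suc j are exactly the composites ψ′ j ∘ t.
  ∑Fun-ψ′ : ∀ {n k} (j : Fin k) (F : (Fin n → Fin (suc k)) → Carrier) →
            F Preserves _≗_ ⟶ _≈_ → (∀ g p → g p ≡ suc j → F g ≈ 0#) →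
            ∑Fun R F ≈ ∑Fun R (λ t → F (ψ′ j ∘ t))
  ∑Fun-ψ′ {zero}  j F F-cong F-vanishes = F-cong λ ()
  ∑Fun-ψ′ {suc n} {k} j F F-cong F-vanishes = begin
    ∑ R (λ v → ∑Fun R (F ∘ cons v))     ≈⟨ ∑-cong (λ v → ∑Fun-ψ′ j (F ∘ cons v) (F-cong ∘ cons-cong v)
                                             λ g p → F-vanishes (cons v g) (suc p)) ⟩
    ∑ R G                               ≈⟨ ∑-ψ′ j G ⟩
    ∑ R (G ∘ ψ′ j) + G (suc j)          ≈⟨ +-congˡ (∑Fun-zero {n} λ t → F-vanishes _ zero refl) ⟩
    ∑ R (G ∘ ψ′ j) + 0#                 ≈⟨ +-identityʳ _ ⟩
    ∑ R (G ∘ ψ′ j)                      ≈⟨ ∑-cong (λ v → ∑Fun-cong {n} λ t → F-cong (cons-∘ (ψ′ j) v t)) ⟩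
    ∑Fun R (λ t → F (ψ′ j ∘ t))         ∎
    where
    G : Fin (suc k) → Carrier
    G v = ∑Fun R (λ t → F (cons v (ψ′ j ∘ t)))

  ifThen0-cong : ∀ {b b′ : Bool} {x x′} → b ≡ b′ → x ≈ x′ → (if b then x else 0#) ≈ (if b′ then x′ else 0#)
  ifThen0-cong {true}  refl x≈x′ = x≈x′
  ifThen0-cong {false} refl _    = ≈-refl

  *-ifThen0 : ∀ (b : Bool) a x → a * (if b then x else 0#) ≈ (if b then a * x else 0#)
  *-ifThen0 true  a x = ≈-refl
  *-ifThen0 false a x = zeroʳ a

  cyclTerm : ∀ {N} → Matrix R N → (Fin N → Fin N) → Carrier
  cyclTerm B s = if does (isFullCycle? s) then ∏ R (λ p → B p (s p)) else 0#

  cyclTerm-cong : ∀ {N} (B : Matrix R N) → cyclTerm B Preserves _≗_ ⟶ _≈_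
  cyclTerm-cong B {s} {s′} s≗s′ = ifThen0-cong
    (does-⇔ (mk⇔ (isFullCycle-resp-≗ s≗s′) (isFullCycle-resp-≗ (sym ∘ s≗s′)))
            (isFullCycle? s) (isFullCycle? s′))
    (∏-cong λ p → reflexive (cong (B p) (s≗s′ p)))

  cyclTerm-¬isFullCycle : ∀ {N} (B : Matrix R N) {s} → ¬ IsFullCycle s → cyclTerm B s ≈ 0#
  cyclTerm-¬isFullCycle B {s} ¬fc = ifThen0-cong (dec-false (isFullCycle? s) ¬fc) ≈-refl

  cyclTerm-splice : ∀ {k} (A : Matrix R (suc k)) j t →
                    cyclTerm A (splice j t) ≈ A zero (suc j) * cyclTerm (Abar R A j) t
  cyclTerm-splice A j t = ≈-trans
    (ifThen0-cong (does-⇔ (isFullCycle-splice j t) (isFullCycle? (splice j t)) (isFullCycle? t)) ≈-refl)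
    (≈-sym (*-ifThen0 (does (isFullCycle? t)) _ _))

  Cycl-expansion : ∀ k (A : Matrix R (suc (suc k))) →
                   Cycl R A ≈ ∑ R (λ j → A zero (suc j) * Cycl R (Abar R A j))
  Cycl-expansion k A = begin
    firstStep zero + ∑ R (firstStep ∘ suc)   ≈⟨ +-congʳ (∑Fun-zero {suc k} λ g → cyclTerm-¬isFullCycle A
                                                  (¬isFullCycle-fixedPoint {s = cons zero g} {x = zero} refl)) ⟩
    0# + ∑ R (firstStep ∘ suc)               ≈⟨ +-identityˡ _ ⟩
    ∑ R (firstStep ∘ suc)                    ≈⟨ ∑-cong firstStep-suc ⟩
    ∑ R (λ j → A zero (suc j) * Cycl R (Abar R A j)) ∎
    where
    firstStep : Fin (suc (suc k)) → Carrier
    firstStep v = ∑Fun R (cyclTerm A ∘ cons v)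

    firstStep-suc : ∀ j → firstStep (suc j) ≈ A zero (suc j) * Cycl R (Abar R A j)
    firstStep-suc j = begin
      ∑Fun R (cyclTerm A ∘ cons (suc j))
        ≈⟨ ∑Fun-ψ′ j (cyclTerm A ∘ cons (suc j)) (cyclTerm-cong A ∘ cons-cong (suc j))
             (λ g p gp≡j+1 → cyclTerm-¬isFullCycle A (¬isFullCycle-cons-repeat p gp≡j+1)) ⟩
      ∑Fun R (cyclTerm A ∘ splice j)
        ≈⟨ ∑Fun-cong {suc k} (cyclTerm-splice A j) ⟩
      ∑Fun R (λ t → A zero (suc j) * cyclTerm (Abar R A j) t)
        ≈⟨ *-distribˡ-∑Fun {suc k} (A zero (suc j)) (cyclTerm (Abar R A j)) ⟨
      A zero (suc j) * Cycl R (Abar R A j) ∎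

mainTheorem4 : ∀ {c ℓ : Level} (R : CommutativeRing c ℓ) (k : ℕ) → 2 ≤ k →
    (A : Matrix R (suc k)) →
    CommutativeRing._≈_ R (Cycl R A)
      (∑ R (λ (j' : Fin k) → CommutativeRing._*_ R (A zero (suc j')) (Cycl R (Abar R A j'))))
mainTheorem4 R (suc (suc k)) (s≤s (s≤s z≤n)) A = Cycl-expansion R (suc k) A
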